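{- Let $\varphi,\delta$ be patterns and $x$ an element variable such that $x$ is free for $\delta$ in $\varphi$. Let $\mathcal A$ be a structure such that for every $\mathcal A$-valuation $e$ there exists $a_e\in A$ with $\bar e(\delta)=\{a_e\}$. Then for every $\mathcal A$-valuation $e$, $\bar e(\varphi[\delta/x])=\overline{e[a_e/x]}(\varphi)$.
   Context: Patterns over pairwise disjoint sets $EVar$ (element variables), $SVar$ (set variables) and constants $\Sigma$: $\varphi ::= x \mid X \mid \sigma \mid \varphi\,\varphi \mid \varphi\to\varphi \mid \exists x.\varphi \mid \mu X.\varphi$; $\exists x$ binds $x$, $\mu X$ binds $X$, $FV$ = free variables. Structure $\mathcal A=(A,\cdot,(\sigma^{\mathcal A}))$: $A\ne\emptyset$, $\cdot:A\times A\to 2^A$, $\sigma^{\mathcal A}\subseteq A$; $B\cdot C:=\bigcup_{b\in B,c\in C}b\cdot c$. Valuations $e$ send element variables into $A$, set variables to subsets of $A$; $e[a/x]$, $e[B/X]$ are updates. $\bar e(x)=\{e(x)\}$, $\bar e(X)=e(X)$, $\bar e(\sigma)=\sigma^{\mathcal A}$, $\bar e(\varphi\psi)=\bar e(\varphi)\cdot\bar e(\psi)$, $\bar e(\varphi\to\psi)=A\setminus(\bar e(\varphi)\setminus\bar e(\psi))$, $\bar e(\exists x.\varphi)=\bigcup_{a}\overline{e[a/x]}(\varphi)$, $\bar e(\mu X.\varphi)=\bigcap\{B\subseteq A:\overline{e[B/X]}(\varphi)\subseteq B\}$. $\varphi[\delta/x]$ is obtained by replacing every free occurrence of $x$ in $\varphi$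 by $\delta$. $x$ is free for $\delta$ in $\varphi$ if no free occurrence of $x$ in $\varphi$ lies within the scope $\theta$ of a subpattern $\exists z.\theta$ of $\varphi$ with $z\in FV(\delta)$ or of a subpattern $\mu Z.\theta$ with $Z\in FV(\delta)$. -}

module Defs where

open import Level using (Level; Lift; _⊔_) renaming (suc to lsuc)
open import Data.Nat using (ℕ; _≡ᵇ_)
open import Data.Bool using (if_then_else_)
open import Data.Product using (Σ; _×_; ∃)
open import Data.Sum using (_⊎_)
open import Data.Empty using (⊥)
open import Data.Unit using (⊤)
open import Relation.Nullary using (¬_)
open import Relation.Binary.PropositionalEquality using (_≡_; _≢_)
open import Relation.Unary using (Pred)

-- Element variables and set variables: two disjoint copies of ℕ
-- (kept apart by the constructors of Pattern); constants: an arbitrary type Sig.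
EVar : Set
EVar = ℕ

SVar : Set
SVar = ℕ

data Pattern (Sig : Set) : Set where
  evar  : EVar → Pattern Sig
  svar  : SVar → Pattern Sig
  const : Sig → Pattern Sig
  app   : Pattern Sig → Pattern Sig → Pattern Sig
  imp   : Pattern Sig → Pattern Sig → Pattern Sig
  ex    : EVar → Pattern Sig → Pattern Sig
  mu    : SVar → Pattern Sig → Pattern Sig

module _ {Sig : Set} where

  FreeE : EVar → Pattern Sig → Set
  FreeE x (evar y)  = x ≡ y
  FreeE x (svar _)  = ⊥
  FreeE x (const _) = ⊥
  FreeE x (app φ ψ) = FreeE x φ ⊎ FreeE x ψ
  FreeE x (imp φ ψ) = FreeE x φ ⊎ FreeE x ψ
  FreeE x (ex z φ)  = x ≢ z × FreeE x φ
  FreeE x (mu _ φ)  = FreeE x φ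

  FreeS : SVar → Pattern Sig → Set
  FreeS X (evar _)  = ⊥
  FreeS X (svar Y)  = X ≡ Y
  FreeS X (const _) = ⊥
  FreeS X (app φ ψ) = FreeS X φ ⊎ FreeS X ψ
  FreeS X (imp φ ψ) = FreeS X φ ⊎ FreeS X ψ
  FreeS X (ex _ φ)  = FreeS X φ
  FreeS X (mu Z φ)  = X ≢ Z × FreeS X φ

  -- φ[δ/x]: replace every free occurrence of x in φ by δ (no renaming)
  _[_/_] : Pattern Sig → Pattern Sig → EVar → Pattern Sig
  evar y    [ δ / x ] = if x ≡ᵇ y then δ else evar y
  svar X    [ δ / x ] = svar X
  const σ   [ δ / x ] = const σ
  app φ ψ   [ δ / x ] = app (φ [ δ / x ]) (ψ [ δ / x ])
  imp φ ψ   [ δ / x ] = imp (φ [ δ / x ]) (ψ [ δ / x ])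
  ex z φ    [ δ / x ] = if x ≡ᵇ z then ex z φ else ex z (φ [ δ / x ])
  mu Z φ    [ δ / x ] = mu Z (φ [ δ / x ])

  FreeFor : EVar → Pattern Sig → Pattern Sig → Set
  FreeFor x δ (evar _)  = ⊤
  FreeFor x δ (svar _)  = ⊤
  FreeFor x δ (const _) = ⊤
  FreeFor x δ (app φ ψ) = FreeFor x δ φ × FreeFor x δ ψ
  FreeFor x δ (imp φ ψ) = FreeFor x δ φ × FreeFor x δ ψ
  FreeFor x δ (ex z θ)  = x ≢ z → (FreeE x θ → ¬ FreeE z δ) × FreeFor x δ θ
  FreeFor x δ (mu Z θ)  = (FreeE x θ → ¬ FreeS Z δ) × FreeFor x δ θ

record Structure (Sig : Set) (ℓ : Level) : Set (lsuc ℓ) where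
  field
    Carrier  : Set ℓ
    inhabitant : Carrier
    _·_      : Carrier → Carrier → Pred Carrier ℓ
    interp   : Sig → Pred Carrier ℓ

module _ {Sig : Set} {ℓ : Level} (𝒜 : Structure Sig ℓ) where
  open Structure 𝒜

  record Valuation : Set (lsuc ℓ) where
    field
      ev : EVar → Carrier
      sv : SVar → Pred Carrier ℓ
  open Valuation public

  updE : Valuation → Carrier → EVar → Valuation
  updE e a x = record { ev = λ y → if x ≡ᵇ y then a else ev e y ; sv = sv e }

  updS : Valuation → Pred Carrier ℓ → SVar → Valuation
  updS e B X = record { ev = ev e ; sv = λ Y → if X ≡ᵇ Y then B else sv e Y }

  ⟦_⟧ : Pattern Sig → Valuation → Pred Carrier (lsuc ℓ)
  ⟦ evar x ⟧ e a    = Lift (lsuc ℓ) (a ≡ ev e x)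
  ⟦ svar X ⟧ e a    = Lift (lsuc ℓ) (sv e X a)
  ⟦ const σ ⟧ e a   = Lift (lsuc ℓ) (interp σ a)
  ⟦ app φ ψ ⟧ e a   = Σ Carrier λ b → Σ Carrier λ c →
                        ⟦ φ ⟧ e b × ⟦ ψ ⟧ e c × Lift (lsuc ℓ) ((b · c) a)
  ⟦ imp φ ψ ⟧ e a   = ¬ (⟦ φ ⟧ e a × ¬ ⟦ ψ ⟧ e a)   -- a ∈ A ∖ (ē(φ) ∖ ē(ψ))
  ⟦ ex x φ ⟧ e a    = Σ Carrier λ c → ⟦ φ ⟧ (updE e c x) a
  ⟦ mu X φ ⟧ e a    = (B : Pred Carrier ℓ) →
                        ((b : Carrier) → ⟦ φ ⟧ (updS e B X) b → B b) → B a

-- By induction on φ, for a fixed element a: it suffices that δ denotes {a}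
-- under the current valuation whenever x occurs free in φ.  Under a binder
-- ∃z / μZ the body is evaluated in an updated valuation; if x occurs in the
-- body, then z (resp. Z) is not free in δ because x is free for δ, so by the
-- coincidence lemma δ still denotes {a} there, and the update of z commutes
-- with the update of x.  In particular the hypothesis on δ is only needed at e.
module Submission where

open import Defs
open import Level using (Level; _⊔_; lift; lower)
open import Data.Bool using (true; false; if_then_else_)
open import Data.Bool.Properties using (T-≡; ¬-not; if-cong)
open import Data.Nat using (ℕ; _≡ᵇ_)
open import Data.Nat.Properties using (_≟_; ≡ᵇ⇒≡; ≡⇒≡ᵇ)
open import Data.Product using (Σ; _,_; proj₁; proj₂)
open import Data.Sum using (inj₁; inj₂)
open import Function using (_∘_)
open import Function.Bundles using (_⇔_; mk⇔; Equivalence)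
import Function.Properties.Equivalence as ⇔
open import Relation.Nullary using (¬_; yes; no)
open import Relation.Binary.PropositionalEquality using (_≡_; _≢_; refl; sym)
open import Relation.Unary using (Pred)

open Equivalence

private
  variable
    a p q r : Level
    A : Set a
    x y : ℕ
    u v w : A

≡ᵇ-refl : ∀ x → (x ≡ᵇ x) ≡ true
≡ᵇ-refl x = to T-≡ (≡⇒≡ᵇ x x refl)

≢⇒≡ᵇ≡false : x ≢ y → (x ≡ᵇ y) ≡ false
≢⇒≡ᵇ≡false x≢y = ¬-not (x≢y ∘ ≡ᵇ⇒≡ _ _ ∘ from T-≡)

if-≡ᵇ-≢ : x ≢ y → (if x ≡ᵇ y then u else v) ≡ v
if-≡ᵇ-≢ x≢y = if-cong (≢⇒≡ᵇ≡false x≢y)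

if-≡ᵇ-cong-else : (x ≢ y → u ≡ v) → (if x ≡ᵇ y then w else u) ≡ (if x ≡ᵇ y then w else v)
if-≡ᵇ-cong-else {x} {y} u≡v with x ≟ y
... | yes refl rewrite ≡ᵇ-refl x = refl
... | no x≢y   rewrite ≢⇒≡ᵇ≡false x≢y = u≡v x≢y

infix 4 _≋_

_≋_ : {A : Set a} → Pred A p → Pred A q → Set (a ⊔ p ⊔ q)
P ≋ Q = ∀ b → P b ⇔ Q b

≋-sym : {P : Pred A p} {Q : Pred A q} → P ≋ Q → Q ≋ P
≋-sym P≋Q b = ⇔.sym (P≋Q b)

≋-trans : {P : Pred A p} {Q : Pred A q} {R : Pred A r} → P ≋ Q → Q ≋ R → P ≋ R
≋-trans P≋Q Q≋R b = ⇔.trans (P≋Q b) (Q≋R b)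

module _ {Sig : Set} {ℓ : Level} (𝒜 : Structure Sig ℓ) where
  private
    variable
      φ φ′ ψ ψ′ : Pattern Sig
      e e′ : Valuation 𝒜
      z Z : ℕ

  ⟦app⟧-cong : ⟦ 𝒜 ⟧ φ e ≋ ⟦ 𝒜 ⟧ φ′ e′ → ⟦ 𝒜 ⟧ ψ e ≋ ⟦ 𝒜 ⟧ ψ′ e′ →
               ⟦ 𝒜 ⟧ (app φ ψ) e ≋ ⟦ 𝒜 ⟧ (app φ′ ψ′) e′
  ⟦app⟧-cong φ≋ ψ≋ _ =
    mk⇔ (λ (c , d , c∈ , d∈ , b∈cd) → c , d , to (φ≋ c) c∈ , to (ψ≋ d) d∈ , b∈cd)
        (λ (c , d , c∈ , d∈ , b∈cd) → c , d , from (φ≋ c) c∈ , from (ψ≋ d) d∈ , b∈cd)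

  ⟦imp⟧-cong : ⟦ 𝒜 ⟧ φ e ≋ ⟦ 𝒜 ⟧ φ′ e′ → ⟦ 𝒜 ⟧ ψ e ≋ ⟦ 𝒜 ⟧ ψ′ e′ →
               ⟦ 𝒜 ⟧ (imp φ ψ) e ≋ ⟦ 𝒜 ⟧ (imp φ′ ψ′) e′
  ⟦imp⟧-cong φ≋ ψ≋ b =
    mk⇔ (λ ¬φ∖ψ (b∈φ′ , b∉ψ′) → ¬φ∖ψ (from (φ≋ b) b∈φ′ , b∉ψ′ ∘ to (ψ≋ b)))
        (λ ¬φ∖ψ (b∈φ , b∉ψ) → ¬φ∖ψ (to (φ≋ b) b∈φ , b∉ψ ∘ from (ψ≋ b)))

  ⟦ex⟧-cong : (∀ c → ⟦ 𝒜 ⟧ φ (updE 𝒜 e c z) ≋ ⟦ 𝒜 ⟧ φ′ (updE 𝒜 e′ c z)) →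
              ⟦ 𝒜 ⟧ (ex z φ) e ≋ ⟦ 𝒜 ⟧ (ex z φ′) e′
  ⟦ex⟧-cong φ≋ b = mk⇔ (λ (c , b∈) → c , to (φ≋ c b) b∈) (λ (c , b∈) → c , from (φ≋ c b) b∈)

  ⟦mu⟧-cong : (∀ B → ⟦ 𝒜 ⟧ φ (updS 𝒜 e B Z) ≋ ⟦ 𝒜 ⟧ φ′ (updS 𝒜 e′ B Z)) →
              ⟦ 𝒜 ⟧ (mu Z φ) e ≋ ⟦ 𝒜 ⟧ (mu Z φ′) e′
  ⟦mu⟧-cong φ≋ b =
    mk⇔ (λ b∈ B closed → b∈ B λ c → closed c ∘ to (φ≋ B c))
        (λ b∈ B closed → b∈ B λ c → closed c ∘ from (φ≋ B c))

  ⟦⟧-coincidence : ∀ φ → (∀ y → FreeE y φ → ev e y ≡ ev e′ y) →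
                   (∀ Y → FreeS Y φ → sv e Y ≡ sv e′ Y) → ⟦ 𝒜 ⟧ φ e ≋ ⟦ 𝒜 ⟧ φ e′
  ⟦⟧-coincidence (evar y) agreeE _ rewrite agreeE y refl = λ _ → ⇔.refl
  ⟦⟧-coincidence (svar Y) _ agreeS rewrite agreeS Y refl = λ _ → ⇔.refl
  ⟦⟧-coincidence (const σ) _ _ = λ _ → ⇔.refl
  ⟦⟧-coincidence (app φ ψ) agreeE agreeS =
    ⟦app⟧-cong (⟦⟧-coincidence φ (λ y → agreeE y ∘ inj₁) (λ Y → agreeS Y ∘ inj₁))
               (⟦⟧-coincidence ψ (λ y → agreeE y ∘ inj₂) (λ Y → agreeS Y ∘ inj₂))
  ⟦⟧-coincidence (imp φ ψ) agreeE agreeS =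
    ⟦imp⟧-cong (⟦⟧-coincidence φ (λ y → agreeE y ∘ inj₁) (λ Y → agreeS Y ∘ inj₁))
               (⟦⟧-coincidence ψ (λ y → agreeE y ∘ inj₂) (λ Y → agreeS Y ∘ inj₂))
  ⟦⟧-coincidence (ex z θ) agreeE agreeS = ⟦ex⟧-cong {z = z} λ c →
    ⟦⟧-coincidence θ (λ y y∈θ → if-≡ᵇ-cong-else λ z≢y → agreeE y ((z≢y ∘ sym) , y∈θ)) agreeS
  ⟦⟧-coincidence (mu Z θ) agreeE agreeS = ⟦mu⟧-cong {Z = Z} λ B →
    ⟦⟧-coincidence θ agreeE (λ Y Y∈θ → if-≡ᵇ-cong-else λ Z≢Y → agreeS Y ((Z≢Y ∘ sym) , Y∈θ))

  ⟦⟧-updE-nonfree : ∀ φ {c} → ¬ FreeE z φ → ⟦ 𝒜 ⟧ φ e ≋ ⟦ 𝒜 ⟧ φ (updE 𝒜 e c z)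
  ⟦⟧-updE-nonfree {z} φ z∉φ =
    ⟦⟧-coincidence φ (λ y y∈φ → sym (if-≡ᵇ-≢ {x = z} λ { refl → z∉φ y∈φ })) (λ _ _ → refl)

  ⟦⟧-updS-nonfree : ∀ φ {B} → ¬ FreeS Z φ → ⟦ 𝒜 ⟧ φ e ≋ ⟦ 𝒜 ⟧ φ (updS 𝒜 e B Z)
  ⟦⟧-updS-nonfree {Z} φ Z∉φ =
    ⟦⟧-coincidence φ (λ _ _ → refl) (λ Y Y∈φ → sym (if-≡ᵇ-≢ {x = Z} λ { refl → Z∉φ Y∈φ }))

  ⟦⟧-updE-comm : ∀ φ {a c} → x ≢ z →
                 ⟦ 𝒜 ⟧ φ (updE 𝒜 (updE 𝒜 e c z) a x) ≋ ⟦ 𝒜 ⟧ φ (updE 𝒜 (updE 𝒜 e a x) c z)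
  ⟦⟧-updE-comm {x} {z} {e} φ {a} {c} x≢z = ⟦⟧-coincidence φ (λ y _ → comm y) (λ _ _ → refl)
    where
    comm : ∀ y → ev (updE 𝒜 (updE 𝒜 e c z) a x) y ≡ ev (updE 𝒜 (updE 𝒜 e a x) c z) y
    comm y with x ≟ y
    ... | yes refl rewrite ≡ᵇ-refl x | ≢⇒≡ᵇ≡false (x≢z ∘ sym) = refl
    ... | no x≢y   rewrite ≢⇒≡ᵇ≡false x≢y = refl

  ⟦⟧-subst : ∀ φ δ x → FreeFor x δ φ → ∀ e a → (FreeE x φ → ⟦ 𝒜 ⟧ δ e ≋ (_≡ a)) →
             ⟦ 𝒜 ⟧ (φ [ δ / x ]) e ≋ ⟦ 𝒜 ⟧ φ (updE 𝒜 e a x)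
  ⟦⟧-subst (evar y) δ x _ e a δ≋a with x ≟ y
  ... | yes refl rewrite ≡ᵇ-refl x =
    λ b → mk⇔ (lift ∘ to (δ≋a refl b)) (from (δ≋a refl b) ∘ lower)
  ... | no x≢y rewrite ≢⇒≡ᵇ≡false x≢y = λ _ → ⇔.refl
  ⟦⟧-subst (svar X) δ x _ e a _ = λ _ → ⇔.refl
  ⟦⟧-subst (const σ) δ x _ e a _ = λ _ → ⇔.refl
  ⟦⟧-subst (app φ ψ) δ x (φ-ok , ψ-ok) e a δ≋a =
    ⟦app⟧-cong (⟦⟧-subst φ δ x φ-ok e a (δ≋a ∘ inj₁)) (⟦⟧-subst ψ δ x ψ-ok e a (δ≋a ∘ inj₂))
  ⟦⟧-subst (imp φ ψ) δ x (φ-ok , ψ-ok) e a δ≋a =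
    ⟦imp⟧-cong (⟦⟧-subst φ δ x φ-ok e a (δ≋a ∘ inj₁)) (⟦⟧-subst ψ δ x ψ-ok e a (δ≋a ∘ inj₂))
  ⟦⟧-subst (ex z θ) δ x θ-ok e a δ≋a with x ≟ z
  ... | yes refl rewrite ≡ᵇ-refl x = ⟦⟧-updE-nonfree (ex x θ) λ (x≢x , _) → x≢x refl
  ... | no x≢z rewrite ≢⇒≡ᵇ≡false x≢z = ⟦ex⟧-cong {z = z} λ c →
    ≋-trans (⟦⟧-subst θ δ x (proj₂ (θ-ok x≢z)) (updE 𝒜 e c z) a λ x∈θ →
               ≋-trans (≋-sym (⟦⟧-updE-nonfree δ (proj₁ (θ-ok x≢z) x∈θ))) (δ≋a (x≢z , x∈θ)))
            (⟦⟧-updE-comm θ x≢z)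
  -- updE and updS change different fields, so they commute definitionally.
  ⟦⟧-subst (mu Z θ) δ x (Z∉δ , θ-ok) e a δ≋a = ⟦mu⟧-cong {Z = Z} λ B →
    ⟦⟧-subst θ δ x θ-ok (updS 𝒜 e B Z) a λ x∈θ →
      ≋-trans (≋-sym (⟦⟧-updS-nonfree δ (Z∉δ x∈θ))) (δ≋a x∈θ)

mainTheorem5 : {Sig : Set} {ℓ : Level} (φ δ : Pattern Sig) (x : EVar) →
    FreeFor x δ φ → (𝒜 : Structure Sig ℓ) →
    (h : (e : Valuation 𝒜) → Σ (Structure.Carrier 𝒜) λ a →
           (b : Structure.Carrier 𝒜) → ⟦ 𝒜 ⟧ δ e b ⇔ (b ≡ a)) →
    (e : Valuation 𝒜) (b : Structure.Carrier 𝒜) →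
    ⟦ 𝒜 ⟧ (φ [ δ / x ]) e b ⇔ ⟦ 𝒜 ⟧ φ (updE 𝒜 e (proj₁ (h e)) x) b
mainTheorem5 φ δ x x-free-for-δ 𝒜 h e =
  ⟦⟧-subst 𝒜 φ δ x x-free-for-δ e (proj₁ (h e)) (λ _ → proj₂ (h e))
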